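{- For every graph $\Gamma$ and all $k,r\in\mathbb N$, $\overline{\mathrm{WL}}_{k,r}(\Gamma)\preceq\overline{\mathrm C}_{k+r,r}(\Gamma)$. In particular $\overline{\mathrm{WL}}_k(\Gamma)\preceq\overline{\mathrm C}_{k+1}(\Gamma)$.
   Context: All sets finite. $[k]^{(r)}$: $r$-tuples of pairwise distinct elements of $[k]=\{1,\dots,k\}$. A labelled partition of $A$ is a function $\gamma:A\to L$; $\gamma\preceq\rho$ means $\rho(a)=\rho(b)\Rightarrow\gamma(a)=\gamma(b)$, $\gamma\approx\rho$ means both directions. $\vec v\langle\vec i,\vec u\rangle$ is $\vec v\in V^k$ with $u_s$ put in position $i_s$. $\mathrm{pr}_t\gamma(w_1,\dots,w_t)=\gamma(w_1,\dots,w_t,w_t,\dots,w_t)$. A graph with vertex set $V$ is a labelled partition $\Gamma$ of $V^2$; $\alpha_{k,\Gamma}(\vec v)=(\Gamma(v_i,v_j))_{(i,j)\in[k]^{(2)}}$. For a $k$-refinement operator $R$ (a map $\gamma\mapsto R\circ\gamma$ on $\mathcal P(V^k)$ with $\gamma\preceq R\circ\gamma$), $[\gamma]^R$ is the first $X^s$ with $X^s\approx R\circ X^s$ in $X^0=\gamma$, $X^i=R\circ X^{i-1}$. For $k\le r$, $\mathrm{WL}_{k,r}\circ\gamma=\mathrm C_{k,r}\circ\gamma=\gamma$; for $r<k$, $\mathrm{WL}_{k,r}\circ\gamma(\vec v)=\big(\gamma(\vec v),\{\{(\gamma(\vec v\langle\vec i,\vec x\rangle))_{\vec i\in[k]^{(r)}}:\vec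 x\in V^r\}\}\big)$, $\mathrm C_{k,r}\circ\gamma(\vec v)=\big(\gamma(\vec v),(\{\{\gamma(\vec v\langle\vec i,\vec x\rangle):\vec x\in V^r\}\})_{\vec i\in[k]^{(r)}}\big)$ (multisets); $\mathrm{WL}_k=\mathrm{WL}_{k,1}$, $\mathrm C_k=\mathrm C_{k,1}$. For an operator family $R_k$: $\overline R_1(\Gamma)=\Gamma$ and $\overline R_k(\Gamma)=\mathrm{pr}_2[\alpha_{k,\Gamma}]^{R_k}$ for $k\ge2$; this defines $\overline{\mathrm{WL}}_{k,r},\overline{\mathrm C}_{k,r},\overline{\mathrm{WL}}_k,\overline{\mathrm C}_k$. -}

module Defs where

open import Level using (0ℓ)
open import Data.Nat using (ℕ; zero; suc; _+_; _<_; _<?_)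
open import Data.Fin using (Fin; zero; suc; _≟_)
open import Data.Product using (Σ; _×_; _,_; proj₁; proj₂)
open import Data.Product.Relation.Binary.Pointwise.NonDependent using (×-setoid)
open import Data.Unit using (⊤)
open import Relation.Nullary using (¬_; yes; no)
open import Relation.Binary using (Setoid)
import Relation.Binary.PropositionalEquality as P
open import Relation.Binary.PropositionalEquality using (_≡_)
open import Function using (_∘_; _↔_; Inverse)
open import Function.Definitions using (Injective)
open import Function.Construct.Symmetry using (↔-sym)
open import Function.Construct.Composition using (_↔-∘_)
open import Function.Construct.Identity using (↔-id)

-- Vertex set V = Fin n (an arbitrary finite set); V^k = Fin k → Fin n.

Tup : ℕ → ℕ → Set
Tup n k = Fin k → Fin n

-- [k]^(r) : r-tuples of pairwise distinct elements of [k]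
--           (= injective maps Fin r → Fin k)
Inj : ℕ → ℕ → Set
Inj k r = Σ (Fin r → Fin k) (Injective _≡_ _≡_)

-- Labelled partitions  γ : A → L.  Since Agda has no quotients, the label
-- set L is a setoid (for plain label sets this is just P.setoid L); label
-- sets built from multisets use multiset equality.

record LP (A : Set) : Set₁ where
  constructor lp
  field
    labels : Setoid 0ℓ 0ℓ
    lab    : A → Setoid.Carrier labels
open LP public

_≼_ : {A : Set} → LP A → LP A → Set
γ ≼ ρ = ∀ a b → Setoid._≈_ (labels ρ) (lab ρ a) (lab ρ b)
              → Setoid._≈_ (labels γ) (lab γ a) (lab γ b)

_≈ₚ_ : {A : Set} → LP A → LP A → Set
γ ≈ₚ ρ = (γ ≼ ρ) × (ρ ≼ γ)

fam-setoid : (I : Set) → Setoid 0ℓ 0ℓ → Setoid 0ℓ 0ℓ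
fam-setoid I S = record
  { Carrier = I → Carrier
  ; _≈_ = λ f g → ∀ i → f i ≈ g i
  ; isEquivalence = record
    { refl = λ i → refl
    ; sym = λ p i → sym (p i)
    ; trans = λ p q i → trans (p i) (q i) } }
  where open Setoid S

-- multisets {{ f x : x ∈ I }} for a finite index set I: two families give
-- the same multiset iff they agree up to a permutation of I
mset-setoid : (I : Set) → Setoid 0ℓ 0ℓ → Setoid 0ℓ 0ℓ
mset-setoid I S = record
  { Carrier = I → Carrier
  ; _≈_ = λ f g → Σ (I ↔ I) λ π → ∀ x → f x ≈ g (Inverse.to π x)
  ; isEquivalence = record
    { refl = ↔-id I , λ x → refl
    ; sym = λ {f} {g} → λ { (π , p) → ↔-sym π , λ y →
        sym (P.subst (λ z → f (Inverse.from π y) ≈ g z)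
                     (Inverse.strictlyInverseˡ π y) (p (Inverse.from π y))) }
    ; trans = λ { (π , p) (σ , q) → (σ ↔-∘ π) , λ x → trans (p x) (q (Inverse.to π x)) } } }
  where open Setoid S

-- v⟨i,u⟩ : v with u_s put in position i_s

upd : ∀ {k} {A : Set} → (Fin k → A) → Fin k → A → Fin k → A
upd v i a j with j ≟ i
... | yes _ = a
... | no  _ = v j

_⟨_,_⟩ : ∀ {n k r} → Tup n k → (Fin r → Fin k) → Tup n r → Tup n k
_⟨_,_⟩ {r = zero}  v i u = v
_⟨_,_⟩ {r = suc r} v i u = upd (v ⟨ i ∘ suc , u ∘ suc ⟩) (i zero) (u zero)

Op : ℕ → ℕ → Set₁
Op n k = LP (Tup n k) → LP (Tup n k)

WL-step : (n k r : ℕ) → Op n k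
WL-step n k r γ =
  lp (×-setoid (labels γ) (mset-setoid (Tup n r) (fam-setoid (Inj k r) (labels γ))))
     (λ v → lab γ v , λ x i → lab γ (v ⟨ proj₁ i , x ⟩))

C-step : (n k r : ℕ) → Op n k
C-step n k r γ =
  lp (×-setoid (labels γ) (fam-setoid (Inj k r) (mset-setoid (Tup n r) (labels γ))))
     (λ v → lab γ v , λ i x → lab γ (v ⟨ proj₁ i , x ⟩))

WL : (n k r : ℕ) → Op n k
WL n k r γ with r <? k
... | yes _ = WL-step n k r γ
... | no  _ = γ

C : (n k r : ℕ) → Op n k
C n k r γ with r <? k
... | yes _ = C-step n k r γ
... | no  _ = γ

iter : ∀ {n k} → Op n k → LP (Tup n k) → ℕ → LP (Tup n k)
iter R γ zero    = γ
iter R γ (suc i) = R (iter R γ i)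

-- s is the first index with X^s ≈ R ∘ X^s, so [γ]^R = iter R γ s
FirstStable : ∀ {n k} → Op n k → LP (Tup n k) → ℕ → Set
FirstStable R γ s =
  (iter R γ s ≈ₚ R (iter R γ s)) ×
  (∀ j → j < s → ¬ (iter R γ j ≈ₚ R (iter R γ j)))

graph : ∀ {n} (L : Set) → (Fin n × Fin n → L) → LP (Fin n × Fin n)
graph L Γ = lp (P.setoid L) Γ

α : ∀ {n} (L : Set) → (Fin n × Fin n → L) → (k : ℕ) → LP (Tup n k)
α L Γ k = lp (fam-setoid (Inj k 2) (P.setoid L))
             (λ v ij → Γ (v (proj₁ ij zero) , v (proj₁ ij (suc zero))))

ext : ∀ {n k} → Fin n → Fin n → Tup n (suc (suc k))
ext a b zero    = a
ext a b (suc _) = b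

pr₂ : ∀ {n k} → LP (Tup n (suc (suc k))) → LP (Fin n × Fin n)
pr₂ γ = lp (labels γ) (λ { (a , b) → lab γ (ext a b) })

-- \overline R_k(Γ), given the stabilisation index s of the iteration.
-- (k = 0 is not defined in the paper; the value there is a dummy.)

barR : ∀ {n} → ((k : ℕ) → Op n k) → (L : Set) → (Fin n × Fin n → L)
     → (k : ℕ) → ℕ → LP (Fin n × Fin n)
barR R L Γ zero                s = graph L Γ
barR R L Γ (suc zero)          s = graph L Γ
barR R L Γ k@(suc (suc _))     s = pr₂ (iter (R k) (α L Γ k) s)

BarIndex : ∀ {n} → ((k : ℕ) → Op n k) → (L : Set) → (Fin n × Fin n → L)
         → (k : ℕ) → ℕ → Set
BarIndex R L Γ zero            s = ⊤
BarIndex R L Γ (suc zero)      s = ⊤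
BarIndex R L Γ k@(suc (suc _)) s = FirstStable (R k) (α L Γ k) s

-- Let Y be the stable C_{k+r,r}-colouring of α_{k+r,Γ}, and call a pair of
-- disjoint injections σ : [k] → [k+r], τ : [r] → [k+r] a frame. By induction on
-- the WL_{k,r}-iteration, every colouring X in it is determined by Y on every
-- frame: Y(u) = Y(u') implies X(u ∘ σ) = X(u' ∘ σ). For the inductive step,
-- stability of Y under C_{k+r,r} at the coordinates τ yields ONE bijection π of
-- V^r with Y(u⟨τ,x⟩) = Y(u'⟨τ,πx⟩) for all x; and for every i ∈ [k]^(r),
-- (u ∘ σ)⟨i,x⟩ = u⟨τ,x⟩ ∘ σ' for the exchanged frame σ' = σ⟨i,τ⟩, τ' = σ ∘ i.
-- So the same π witnesses the multiset condition of WL_{k,r} for all i at once.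
-- Projecting to pairs along the standard frame (σ the first k positions, τ the
-- last r) gives the comparison of the graphs.
module Submission where

open import Defs
open import Data.Nat using (ℕ; zero; suc; _+_; _≤_; _<_; _<?_; s≤s)
open import Data.Nat.Properties using (m≤n+m)
open import Data.Fin using (Fin; zero; suc; _≟_; _↑ˡ_; _↑ʳ_)
open import Data.Fin.Properties using (any?; 0≢1+n; suc-injective; ↑ˡ-injective; ↑ʳ-injective)
open import Data.Product using (_×_; _,_; proj₁; proj₂; ∃)
open import Data.Sum using (_⊎_; inj₁; inj₂)
open import Data.Empty using (⊥-elim)
open import Relation.Nullary using (yes; no)
open import Level using (0ℓ) renaming (suc to lsuc)
open import Relation.Binary using (Setoid; Preorder)
import Relation.Binary.Reasoning.Preorder
open import Relation.Binary.PropositionalEquality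
  using (_≡_; _≢_; _≗_; refl; sym; trans; cong; cong₂; isEquivalence)
open import Function using (_∘_; id; Inverse)
open import Function.Definitions using (Injective)
open import Function.Construct.Identity using (↔-id)

≼-trans : ∀ {A} {γ ρ δ : LP A} → γ ≼ ρ → ρ ≼ δ → γ ≼ δ
≼-trans γ≼ρ ρ≼δ a b = γ≼ρ a b ∘ ρ≼δ a b

≼-preorder : Set → Preorder (lsuc 0ℓ) (lsuc 0ℓ) 0ℓ
≼-preorder A = record
  { Carrier = LP A
  ; _≈_ = _≡_
  ; _≲_ = _≼_
  ; isPreorder = record
    { isEquivalence = isEquivalence
    ; reflexive = λ { refl a b → id }
    ; trans = λ {γ ρ δ} → ≼-trans {γ = γ} {ρ} {δ} } }

module ≼-Reasoning {A : Set} = Relation.Binary.Reasoning.Preorder (≼-preorder A)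

iter-refines : ∀ {n k} (R : Op n k) → (∀ γ → γ ≼ R γ) → ∀ γ t → γ ≼ iter R γ t
iter-refines R refines γ zero    a b = id
iter-refines R refines γ (suc t) = begin
  γ               ≲⟨ iter-refines R refines γ t ⟩
  iter R γ t      ≲⟨ refines (iter R γ t) ⟩
  R (iter R γ t)  ∎
  where open ≼-Reasoning

iter-preserves : ∀ {n k} (R : Op n k) (P : LP (Tup n k) → Set) →
                 (∀ γ → P γ → P (R γ)) → ∀ γ → P γ → ∀ s → P (iter R γ s)
iter-preserves R P step γ pγ zero    = pγ
iter-preserves R P step γ pγ (suc s) = step _ (iter-preserves R P step γ pγ s)

C-refines : ∀ n m r γ → γ ≼ C n m r γ
C-refines n m r γ a b with r <? m
... | yes _ = proj₁
... | no  _ = id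

C-step≼C : ∀ {n m r} → r < m → ∀ γ → C-step n m r γ ≼ C n m r γ
C-step≼C {n} {m} {r} r<m γ a b with r <? m
... | yes _   = id
... | no  r≮m = ⊥-elim (r≮m r<m)

α≼iter-C : ∀ n m r {L} (Γ : Fin n × Fin n → L) t → α L Γ m ≼ iter (C n m r) (α L Γ m) t
α≼iter-C n m r Γ t = iter-refines (C n m r) (C-refines n m r) (α _ Γ m) t

WL-elim : ∀ {n k r} (P : LP (Tup n k) → Set) γ →
          P γ → P (WL-step n k r γ) → P (WL n k r γ)
WL-elim {k = k} {r} P γ pγ pstep with r <? k
... | yes _ = pstep
... | no  _ = pγ

⟨⟩-cong : ∀ {n k r} {v v' : Tup n k} (i : Fin r → Fin k) (x : Tup n r) →
          v ≗ v' → v ⟨ i , x ⟩ ≗ v' ⟨ i , x ⟩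
⟨⟩-cong {r = zero}  i x v≗v' = v≗v'
⟨⟩-cong {r = suc r} i x v≗v' j with j ≟ i zero
... | yes _ = refl
... | no  _ = ⟨⟩-cong (i ∘ suc) (x ∘ suc) v≗v' j

⟨⟩-outside : ∀ {n k r} (v : Tup n k) (i : Fin r → Fin k) (x : Tup n r) {j} →
             (∀ s → j ≢ i s) → (v ⟨ i , x ⟩) j ≡ v j
⟨⟩-outside {r = zero}  v i x j∉i = refl
⟨⟩-outside {r = suc r} v i x {j} j∉i with j ≟ i zero
... | yes j≡i₀ = ⊥-elim (j∉i zero j≡i₀)
... | no  _    = ⟨⟩-outside v (i ∘ suc) (x ∘ suc) (j∉i ∘ suc)

⟨⟩-at : ∀ {n k r} (v : Tup n k) {i : Fin r → Fin k} (x : Tup n r) →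
        Injective _≡_ _≡_ i → ∀ s → (v ⟨ i , x ⟩) (i s) ≡ x s
⟨⟩-at v {i} x i-inj zero with i zero ≟ i zero
... | yes _  = refl
... | no  ¬p = ⊥-elim (¬p refl)
⟨⟩-at v {i} x i-inj (suc s) with i (suc s) ≟ i zero
... | yes p = ⊥-elim (0≢1+n (sym (i-inj p)))
... | no  _ = ⟨⟩-at v (x ∘ suc) (suc-injective ∘ i-inj) s

∈-image? : ∀ {k r} (i : Fin r → Fin k) j → (∃ λ s → j ≡ i s) ⊎ (∀ s → j ≢ i s)
∈-image? i j with any? (λ s → j ≟ i s)
... | yes j∈i = inj₁ j∈i
... | no  j∉i = inj₂ (λ s j≡is → j∉i (s , j≡is))

record Frame (k r K : ℕ) : Set where
  field
    σ        : Fin k → Fin K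
    σ-inj    : Injective _≡_ _≡_ σ
    τ        : Fin r → Fin K
    τ-inj    : Injective _≡_ _≡_ τ
    disjoint : ∀ j s → σ j ≢ τ s

module Exchange {k r K} (f : Frame k r K) (i∈ : Inj k r) where
  open Frame f
  i = proj₁ i∈
  i-inj = proj₂ i∈

  σ' : Fin k → Fin K
  σ' = σ ⟨ i , τ ⟩

  σ'-at : ∀ s → σ' (i s) ≡ τ s
  σ'-at = ⟨⟩-at σ τ i-inj

  σ'-outside : ∀ {j} → (∀ s → j ≢ i s) → σ' j ≡ σ j
  σ'-outside = ⟨⟩-outside σ i τ

  σ'-inj : Injective _≡_ _≡_ σ'
  σ'-inj {a} {b} e with ∈-image? i a | ∈-image? i b
  ... | inj₁ (s , refl) | inj₁ (t , refl) =
        cong i (τ-inj (trans (sym (σ'-at s)) (trans e (σ'-at t))))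
  ... | inj₁ (s , refl) | inj₂ b∉i =
        ⊥-elim (disjoint b s (trans (sym (σ'-outside b∉i)) (trans (sym e) (σ'-at s))))
  ... | inj₂ a∉i | inj₁ (t , refl) =
        ⊥-elim (disjoint a t (trans (sym (σ'-outside a∉i)) (trans e (σ'-at t))))
  ... | inj₂ a∉i | inj₂ b∉i =
        σ-inj (trans (sym (σ'-outside a∉i)) (trans e (σ'-outside b∉i)))

  disjoint' : ∀ j s → σ' j ≢ σ (i s)
  disjoint' j s e with ∈-image? i j
  ... | inj₁ (t , refl) = disjoint (i s) t (sym (trans (sym (σ'-at t)) e))
  ... | inj₂ j∉i        = j∉i s (σ-inj (trans (sym (σ'-outside j∉i)) e))

  exchanged : Frame k r K
  exchanged = record
    { σ = σ' ; σ-inj = σ'-inj ; τ = σ ∘ i ; τ-inj = i-inj ∘ σ-inj ; disjoint = disjoint' }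

  ⟨⟩-exchange : ∀ {n} (u : Tup n K) (x : Tup n r) → u ⟨ τ , x ⟩ ∘ σ' ≗ (u ∘ σ) ⟨ i , x ⟩
  ⟨⟩-exchange u x j with ∈-image? i j
  ... | inj₁ (s , refl) =
        trans (cong (u ⟨ τ , x ⟩) (σ'-at s))
              (trans (⟨⟩-at u x τ-inj s) (sym (⟨⟩-at (u ∘ σ) x i-inj s)))
  ... | inj₂ j∉i =
        trans (cong (u ⟨ τ , x ⟩) (σ'-outside j∉i))
              (trans (⟨⟩-outside u τ x (disjoint j)) (sym (⟨⟩-outside (u ∘ σ) i x j∉i)))

↑ˡ≢↑ʳ : ∀ {k r} (j : Fin k) (s : Fin r) → j ↑ˡ r ≢ k ↑ʳ s
↑ˡ≢↑ʳ zero    s ()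
↑ˡ≢↑ʳ (suc j) s e = ↑ˡ≢↑ʳ j s (suc-injective e)

standardFrame : ∀ k r → Frame k r (k + r)
standardFrame k r = record
  { σ = _↑ˡ r ; σ-inj = ↑ˡ-injective r _ _
  ; τ = k ↑ʳ_ ; τ-inj = ↑ʳ-injective k _ _
  ; disjoint = ↑ˡ≢↑ʳ }

-- Without function extensionality, that labels respect pointwise equality of
-- tuples has to be carried along as an invariant.
Extensional : ∀ {n k} → LP (Tup n k) → Set
Extensional γ = ∀ {u u'} → u ≗ u' → Setoid._≈_ (labels γ) (lab γ u) (lab γ u')

pullback : ∀ {n k K} → (Fin k → Fin K) → LP (Tup n k) → LP (Tup n K)
pullback σ γ = lp (labels γ) (λ u → lab γ (u ∘ σ))

DeterminedBy : ∀ {n K} (k r : ℕ) → LP (Tup n K) → LP (Tup n k) → Set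
DeterminedBy k r Y γ = (f : Frame k r _) → pullback (Frame.σ f) γ ≼ Y

α-extensional : ∀ {n} L (Γ : Fin n × Fin n → L) k → Extensional (α L Γ k)
α-extensional L Γ k u≗u' ij = cong Γ (cong₂ _,_ (u≗u' _) (u≗u' _))

pullback-α : ∀ {n} L (Γ : Fin n × Fin n → L) {k K} {σ : Fin k → Fin K} →
             Injective _≡_ _≡_ σ → pullback σ (α L Γ k) ≼ α L Γ K
pullback-α L Γ {σ = σ} σ-inj u u' u≈u' (ij , ij-inj) = u≈u' (σ ∘ ij , ij-inj ∘ σ-inj)

module _ {n k r : ℕ} where

  WL-step-extensional : ∀ γ → Extensional γ → Extensional (WL-step n k r γ)
  WL-step-extensional γ ext-γ u≗u' =
    ext-γ u≗u' , ↔-id _ , λ x (i , _) → ext-γ (⟨⟩-cong i x u≗u')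

  module _ (Y : LP (Tup n (k + r))) (Y-stable : C-step n (k + r) r Y ≼ Y) where

    WL-step-determinedBy : ∀ γ → Extensional γ → DeterminedBy k r Y γ →
                           DeterminedBy k r Y (WL-step n k r γ)
    WL-step-determinedBy γ ext-γ det f u u' u≈u' =
      det f u u' u≈u' , proj₁ πY , same
      where
        open Frame f
        open Setoid (labels γ) using (_≈_)
        open import Relation.Binary.Reasoning.Setoid (labels γ)
        πY = proj₂ (Y-stable u u' u≈u') (τ , τ-inj)
        π  = Inverse.to (proj₁ πY)
        same : ∀ x i∈ → lab γ ((u ∘ σ) ⟨ proj₁ i∈ , x ⟩)
                     ≈ lab γ ((u' ∘ σ) ⟨ proj₁ i∈ , π x ⟩)
        same x i∈ = begin
          lab γ ((u ∘ σ) ⟨ proj₁ i∈ , x ⟩)    ≈⟨ ext-γ (⟨⟩-exchange u x) ⟨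
          lab γ (u ⟨ τ , x ⟩ ∘ σ')           ≈⟨ det exchanged _ _ (proj₂ πY x) ⟩
          lab γ (u' ⟨ τ , π x ⟩ ∘ σ')        ≈⟨ ext-γ (⟨⟩-exchange u' (π x)) ⟩
          lab γ ((u' ∘ σ) ⟨ proj₁ i∈ , π x ⟩) ∎
          where open Exchange f i∈ using (σ'; exchanged; ⟨⟩-exchange)

    WL-iter-determinedBy : ∀ L (Γ : Fin n × Fin n → L) → α L Γ (k + r) ≼ Y → ∀ s →
      Extensional (iter (WL n k r) (α L Γ k) s) ×
      DeterminedBy k r Y (iter (WL n k r) (α L Γ k) s)
    WL-iter-determinedBy L Γ α≼Y =
      iter-preserves (WL n k r) Invariant
        (λ γ (ext-γ , det) → WL-elim Invariant γ (ext-γ , det)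
          (WL-step-extensional γ ext-γ , WL-step-determinedBy γ ext-γ det))
        (α L Γ k) (α-extensional L Γ k ,
         λ f → begin
           pullback (Frame.σ f) (α L Γ k)  ≲⟨ pullback-α L Γ (Frame.σ-inj f) ⟩
           α L Γ (k + r)                   ≲⟨ α≼Y ⟩
           Y                               ∎)
      where
        Invariant : LP (Tup n k) → Set
        Invariant γ = Extensional γ × DeterminedBy k r Y γ
        open ≼-Reasoning

pr₂-mono : ∀ {n m} (γ ρ : LP (Tup n (suc (suc m)))) → γ ≼ ρ → pr₂ γ ≼ pr₂ ρ
pr₂-mono γ ρ γ≼ρ (a , b) (a' , b') = γ≼ρ (ext a b) (ext a' b')

ext-↑ˡ : ∀ {n m} r (a b : Fin n) → ext {k = m + r} a b ∘ (_↑ˡ r) ≗ ext {k = m} a b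
ext-↑ˡ r a b zero    = refl
ext-↑ˡ r a b (suc j) = refl

pr₂-pullback-↑ˡ : ∀ {n m} r (γ : LP (Tup n (suc (suc m)))) → Extensional γ →
                  pr₂ γ ≼ pr₂ (pullback (_↑ˡ r) γ)
pr₂-pullback-↑ˡ r γ ext-γ (a , b) (a' , b') e =
  ≈-trans (≈-sym (ext-γ (ext-↑ˡ r a b))) (≈-trans e (ext-γ (ext-↑ˡ r a' b')))
  where open Setoid (labels γ) renaming (trans to ≈-trans; sym to ≈-sym)

graph≼pr₂α : ∀ {n} L (Γ : Fin n × Fin n → L) m → graph L Γ ≼ pr₂ (α L Γ (suc (suc m)))
graph≼pr₂α L Γ m (a , b) (a' , b') e = e (_↑ˡ m , ↑ˡ-injective m _ _)

graph≼barC : ∀ {n} L (Γ : Fin n × Fin n → L) r t →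
             graph L Γ ≼ barR (λ m → C n m r) L Γ (1 + r) t
graph≼barC L Γ zero    t a b = id
graph≼barC {n} L Γ (suc r) t = begin
  graph L Γ            ≲⟨ graph≼pr₂α L Γ r ⟩
  pr₂ (α L Γ (2 + r))  ≲⟨ pr₂-mono (α L Γ (2 + r)) Y (α≼iter-C n (2 + r) (suc r) Γ t) ⟩
  pr₂ Y                ∎
  where
    open ≼-Reasoning
    Y = iter (C n (2 + r) (suc r)) (α L Γ (2 + r)) t

barWL≼barC : (n : ℕ) (L : Set) (Γ : Fin n × Fin n → L) →
    ((k r : ℕ) → 1 ≤ k → (s t : ℕ) →
    BarIndex (λ m → WL n m r) L Γ k s →
    BarIndex (λ m → C n m r) L Γ (k + r) t →
    barR (λ m → WL n m r) L Γ k s ≼ barR (λ m → C n m r) L Γ (k + r) t)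
barWL≼barC n L Γ (suc zero) r _ s t _ _ = graph≼barC L Γ r t
barWL≼barC n L Γ k@(suc (suc _)) r _ s t _ ((_ , Y-stable) , _) = begin
  pr₂ X                     ≲⟨ pr₂-pullback-↑ˡ r X ext-X ⟩
  pr₂ (pullback (_↑ˡ r) X)  ≲⟨ pr₂-mono (pullback (_↑ˡ r) X) Y (det (standardFrame k r)) ⟩
  pr₂ Y                     ∎
  where
    open ≼-Reasoning
    X = iter (WL n k r) (α L Γ k) s
    Y = iter (C n (k + r) r) (α L Γ (k + r)) t
    C-step-stable : C-step n (k + r) r Y ≼ Y
    C-step-stable = begin
      C-step n (k + r) r Y  ≲⟨ C-step≼C (s≤s (m≤n+m r _)) Y ⟩
      C n (k + r) r Y       ≲⟨ Y-stable ⟩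
      Y                     ∎
    X-invariant = WL-iter-determinedBy Y C-step-stable L Γ (α≼iter-C n (k + r) r Γ t) s
    ext-X = proj₁ X-invariant
    det = proj₂ X-invariant

corollary4 : (n : ℕ) (L : Set) (Γ : Fin n × Fin n → L) →
    ((k r : ℕ) → 1 ≤ k → (s t : ℕ) →
      BarIndex (λ m → WL n m r) L Γ k s →
      BarIndex (λ m → C n m r) L Γ (k + r) t →
      barR (λ m → WL n m r) L Γ k s ≼ barR (λ m → C n m r) L Γ (k + r) t)
    ×
    ((k : ℕ) → 1 ≤ k → (s t : ℕ) →
      BarIndex (λ m → WL n m 1) L Γ k s →
      BarIndex (λ m → C n m 1) L Γ (k + 1) t →
      barR (λ m → WL n m 1) L Γ k s ≼ barR (λ m → C n m 1) L Γ (k + 1) t)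
corollary4 n L Γ = barWL≼barC n L Γ , λ k → barWL≼barC n L Γ k 1
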